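{- Let $\mathcal{L}$ be a propositional language and $\mathsf{H}$ a class of $\mathcal{L}$-hypermatrices. Then $\models_{\mathsf{H}}$ is a substitution-invariant multiset deductive relation on $\mathcal{L}$.
   Context: For a set $X$, $X^\flat$ is the set of finite multisets over $X$ with sub-multiset order $\leqslant$, multiset sum $\uplus$ and empty multiset; homomorphisms extend to multisets elementwise. An $\mathcal{L}$-hypermatrix is a pair $\langle\mathbf{A},F\rangle$ with $\mathbf{A}$ an $\mathcal{L}$-algebra and $F$ a $\leqslant$-downset of $A^\flat$. For a class $\mathsf{H}$ of hypermatrices and $\Gamma,\Delta\in Fm_{\mathcal{L}}^\flat$, $\Gamma\models_{\mathsf{H}}\Delta$ means: for every $\langle\mathbf{A},F\rangle\in\mathsf{H}$, every $\mathfrak{C}\in A^\flat$ and every homomorphism $f\colon\mathbf{Fm}_{\mathcal{L}}\to\mathbf{A}$, $\mathfrak{C}\uplus f(\Gamma)\in F$ implies $\mathfrak{C}\uplus f(\Delta)\in F$. A multiset deductive relation (MDR) on $\mathcal{L}$ is a relation $\vdash$ on $Fm_{\mathcal{L}}^\flat$ such that $\Gamma\uplus\Delta\vdash\Gamma$; $\Gamma\vdash\Delta\Rightarrow\Gamma\uplus\Pi\vdash\Delta\uplus\Pi$; $\Gamma\vdash\Delta,\Delta\vdash\Pi\Rightarrow\Gamma\vdash\Pi$. It is substitution-invariant if $\Gamma\vdash\Delta$ implies $\sigma(\Gamma)\vdash\sigma(\Delta)$ for all substitutions (endomorphisms of the formula algebra) $\sigma$. -}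

module Defs where

open import Level using (Level; _⊔_; suc)
open import Data.Nat using (ℕ)
open import Data.Fin using (Fin)
open import Data.List using (List; _++_; map)
open import Data.Product using (Σ; ∃; _×_)
open import Data.List.Relation.Binary.Permutation.Propositional using (_↭_)
open import Relation.Binary.PropositionalEquality using (_≡_)

record Language : Set₁ where
  field
    Op    : Set
    arity : Op → ℕ
open Language public

data Fm (L : Language) : Set where
  var : ℕ → Fm L
  op  : (o : Op L) → (Fin (arity L o) → Fm L) → Fm L

record Algebra (L : Language) (a : Level) : Set (suc a) where
  field
    Carrier : Set a
    interp  : (o : Op L) → (Fin (arity L o) → Carrier) → Carrier
open Algebra public

FmAlg : (L : Language) → Algebra L Level.zero
FmAlg L = record { Carrier = Fm L ; interp = op }

IsHom : {L : Language} {a b : Level} (A : Algebra L a) (B : Algebra L b) →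
        (Carrier A → Carrier B) → Set (a ⊔ b)
IsHom {L} A B f = ∀ (o : Op L) (xs : Fin (arity L o) → Carrier A) →
  f (interp A o xs) ≡ interp B o (λ i → f (xs i))

-- Finite multisets over X are represented by lists, considered up to
-- permutation (_↭_); multiset sum is _++_, the empty multiset is [],
-- and functions extend elementwise via map.
_≤ₘ_ : {a : Level} {X : Set a} → List X → List X → Set a
Γ ≤ₘ Δ = ∃ λ Π → (Γ ++ Π) ↭ Δ

record Hypermatrix (L : Language) (a f : Level) : Set (suc (a ⊔ f)) where
  field
    alg     : Algebra L a
    F       : List (Carrier alg) → Set f
    downset : ∀ {Γ Δ} → Γ ≤ₘ Δ → F Δ → F Γ
open Hypermatrix public

_⊨[_]_ : {L : Language} {a f h : Level} →
         List (Fm L) → (Hypermatrix L a f → Set h) → List (Fm L) → Set (suc (a ⊔ f) ⊔ h)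
_⊨[_]_ {L} Γ H Δ =
  ∀ (M : Hypermatrix L _ _) → H M →
  ∀ (C : List (Carrier (alg M))) (g : Fm L → Carrier (alg M)) →
  IsHom (FmAlg L) (alg M) g →
  F M (C ++ map g Γ) → F M (C ++ map g Δ)

-- Multiset deductive relations (on lists, required to respect permutation,
-- i.e. to be a relation on multisets).
record IsMDR {L : Language} {r : Level} (_⊢_ : List (Fm L) → List (Fm L) → Set r) : Set r where
  field
    respects-↭ : ∀ {Γ Γ' Δ Δ'} → Γ ↭ Γ' → Δ ↭ Δ' → Γ ⊢ Δ → Γ' ⊢ Δ'
    weaken     : ∀ Γ Δ → (Γ ++ Δ) ⊢ Γ
    context    : ∀ {Γ Δ} Π → Γ ⊢ Δ → (Γ ++ Π) ⊢ (Δ ++ Π)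
    cut        : ∀ {Γ Δ Π} → Γ ⊢ Δ → Δ ⊢ Π → Γ ⊢ Π

IsSubstInvariant : {L : Language} {r : Level} →
                   (List (Fm L) → List (Fm L) → Set r) → Set r
IsSubstInvariant {L} _⊢_ =
  ∀ (σ : Fm L → Fm L) → IsHom (FmAlg L) (FmAlg L) σ →
  ∀ {Γ Δ} → Γ ⊢ Δ → map σ Γ ⊢ map σ Δ

-- A hypermatrix downset F is closed under permutation, so ⊨ respects multiset
-- equality. Weakening is the downset property; for the context rule the extra
-- premises Π are absorbed into the context C (instantiate the hypothesis at
-- C ⊎ g(Π)); cut is composition; and substitution invariance follows by
-- instantiating the hypothesis at the homomorphism g ∘ σ.
module Submission where

open import Defs
open import Level using (Level)
open import Function using (_∘_)
open import Data.Product using (_×_; _,_)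
open import Data.List using (List; []; _++_; map)
open import Data.List.Properties using (++-identityʳ; ++-assoc; map-++; map-∘)
open import Data.List.Relation.Binary.Permutation.Propositional
  using (_↭_; ↭-sym; ↭-reflexive; module PermutationReasoning)
open import Data.List.Relation.Binary.Permutation.Propositional.Properties
  using (++⁺ˡ; map⁺; ++-comm)
open import Relation.Binary.PropositionalEquality using (_≡_; sym; trans; cong; subst; module ≡-Reasoning)

module _ {L : Language} {a f : Level} (M : Hypermatrix L a f) where

  F-resp-↭ : ∀ {Γ Δ} → Γ ↭ Δ → F M Δ → F M Γ
  F-resp-↭ {Γ} Γ↭Δ = downset M ([] , subst (_↭ _) (sym (++-identityʳ Γ)) Γ↭Δ)

  F-resp-≡ : ∀ {Γ Δ} → Γ ≡ Δ → F M Δ → F M Γ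
  F-resp-≡ Γ≡Δ = F-resp-↭ (↭-reflexive Γ≡Δ)

IsHom-∘ : {L : Language} {a b c : Level}
          (A : Algebra L a) (B : Algebra L b) (C : Algebra L c)
          (g : Carrier B → Carrier C) (h : Carrier A → Carrier B) →
          IsHom B C g → IsHom A B h → IsHom A C (g ∘ h)
IsHom-∘ _ _ _ g _ g-hom h-hom o xs = trans (cong g (h-hom o xs)) (g-hom o _)

++-swapʳ : ∀ {ℓ} {A : Set ℓ} (C X P : List A) → C ++ X ++ P ↭ (C ++ P) ++ X
++-swapʳ C X P = begin
  C ++ X ++ P    ↭⟨ ++⁺ˡ C (++-comm X P) ⟩
  C ++ P ++ X    ≡⟨ ++-assoc C P X ⟨
  (C ++ P) ++ X  ∎
  where open PermutationReasoning

module _ {L : Language} {a f h : Level} {H : Hypermatrix L a f → Set h} where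

  ⊨-resp-↭ : ∀ {Γ Γ' Δ Δ'} → Γ ↭ Γ' → Δ ↭ Δ' → Γ ⊨[ H ] Δ → Γ' ⊨[ H ] Δ'
  ⊨-resp-↭ Γ↭Γ' Δ↭Δ' Γ⊨Δ M M∈H C g g-hom =
    F-resp-↭ M (++⁺ˡ C (map⁺ g (↭-sym Δ↭Δ')))
    ∘ Γ⊨Δ M M∈H C g g-hom
    ∘ F-resp-↭ M (++⁺ˡ C (map⁺ g Γ↭Γ'))

  ⊨-weaken : ∀ Γ Δ → (Γ ++ Δ) ⊨[ H ] Γ
  ⊨-weaken Γ Δ M _ C g _ = downset M (map g Δ , ↭-reflexive (begin
    (C ++ map g Γ) ++ map g Δ  ≡⟨ ++-assoc C (map g Γ) (map g Δ) ⟩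
    C ++ map g Γ ++ map g Δ    ≡⟨ cong (C ++_) (map-++ g Γ Δ) ⟨
    C ++ map g (Γ ++ Δ)        ∎))
    where open ≡-Reasoning

  ⊨-context : ∀ {Γ Δ} Π → Γ ⊨[ H ] Δ → (Γ ++ Π) ⊨[ H ] (Δ ++ Π)
  ⊨-context {Γ} {Δ} Π Γ⊨Δ M M∈H C g g-hom =
    F-resp-↭ M (shift Δ)
    ∘ Γ⊨Δ M M∈H (C ++ map g Π) g g-hom
    ∘ F-resp-↭ M (↭-sym (shift Γ))
    where
    shift : ∀ Θ → C ++ map g (Θ ++ Π) ↭ (C ++ map g Π) ++ map g Θ
    shift Θ = begin
      C ++ map g (Θ ++ Π)          ≡⟨ cong (C ++_) (map-++ g Θ Π) ⟩
      C ++ map g Θ ++ map g Π      ↭⟨ ++-swapʳ C (map g Θ) (map g Π) ⟩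
      (C ++ map g Π) ++ map g Θ    ∎
      where open PermutationReasoning

  ⊨-cut : ∀ {Γ Δ Π} → Γ ⊨[ H ] Δ → Δ ⊨[ H ] Π → Γ ⊨[ H ] Π
  ⊨-cut Γ⊨Δ Δ⊨Π M M∈H C g g-hom = Δ⊨Π M M∈H C g g-hom ∘ Γ⊨Δ M M∈H C g g-hom

  ⊨-isMDR : IsMDR (λ Γ Δ → Γ ⊨[ H ] Δ)
  ⊨-isMDR = record
    { respects-↭ = ⊨-resp-↭
    ; weaken     = ⊨-weaken
    ; context    = ⊨-context
    ; cut        = ⊨-cut
    }

  ⊨-substInvariant : IsSubstInvariant (λ Γ Δ → Γ ⊨[ H ] Δ)
  ⊨-substInvariant σ σ-hom {Γ} {Δ} Γ⊨Δ M M∈H C g g-hom =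
    F-resp-≡ M (cong (C ++_) (sym (map-∘ Δ)))
    ∘ Γ⊨Δ M M∈H C (g ∘ σ) (IsHom-∘ (FmAlg L) (FmAlg L) (alg M) g σ g-hom σ-hom)
    ∘ F-resp-≡ M (cong (C ++_) (map-∘ Γ))

theorem5p6 : {a f h : Level} (L : Language) (H : Hypermatrix L a f → Set h) →
    IsMDR (λ Γ Δ → Γ ⊨[ H ] Δ) × IsSubstInvariant (λ Γ Δ → Γ ⊨[ H ] Δ)
theorem5p6 L H = ⊨-isMDR {H = H} , ⊨-substInvariant {H = H}
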